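{- Let $m\ge1$. For all $n\ge2$, the string $T_n^{(m)}$ is a prefix of the sequence $A^{(m+1)}$, or is all of $A^{(m+1)}$ if $T_n^{(m)}$ is infinite.
   Context: Strings may be finite or infinite. For a nonempty finite string $U$ of positive integers, $\mathcal{C}(U)$ is the largest integer $k\ge1$ with $U=XY^k$ for strings $X,Y$, $Y$ nonempty; $\mathcal{C}^{(m)}(U)=\max\{m,\mathcal{C}(U)\}$. For $m\ge1$ the sequence $A^{(m)}=a^{(m)}(1),a^{(m)}(2),\ldots$ is given by $a^{(m)}(1)=m$, $a^{(m)}(i+1)=\mathcal{C}^{(m)}(a^{(m)}(1),\ldots,a^{(m)}(i))$. Fix $m$. Blocks and glue: $B_1^{(m)}=m$; for $n\ge1$, if $B_n^{(m)}$ is infinite then $B_{n+1}^{(m)}=B_n^{(m)}$ and $S_i^{(m)}=\emptyset$ for $i\ge n$; if $B_n^{(m)}$ is finite, let $s(1)=\mathcal{C}^{(m)}((B_n^{(m)})^{m+1})$, $s(i+1)=\mathcal{C}^{(m)}((B_n^{(m)})^{m+1}s(1)\ldots s(i))$; if some $i\ge1$ has $s(i+1)<m+1$, with $i$ least, $S_n^{(m)}=s(1),\ldots,s(i)$, otherwise $S_n^{(m)}=s(1),s(2),\ldots$ (infinite); and $B_{n+1}^{(m)}=(B_n^{(m)})^{m+1}S_n^{(m)}$. Terminating strings: if $S_1^{(m)},\ldots,S_{n-1}^{(m)}$ are finite, $T_{n+1}^{(m)}=S_1^{(m)}\cdots S_n^{(m)}$; if moreover $S_n^{(m)}$ is infinite,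 then $T_i^{(m)}=T_{n+1}^{(m)}$ for all $i\ge n+2$. -}

module Defs where

open import Data.Nat using (ℕ; zero; suc; _+_; _*_; _∸_; _≤_; _<_; _⊔_; _≤?_)
open import Data.Nat.Properties using () renaming (_≟_ to _≟ℕ_)
open import Data.Bool using (Bool; true; false; _∧_; if_then_else_)
open import Data.List using (List; []; _∷_; _++_; length; take; drop; map; concatMap; foldr; upTo)
open import Data.List.Properties using (≡-dec)
open import Data.Product using (Σ; _×_; _,_)
open import Relation.Nullary using (does)
open import Relation.Binary.PropositionalEquality using (_≡_)

-- Strings are lists of natural numbers (positions are 1-indexed in the paper).

rep : ℕ → List ℕ → List ℕ
rep zero    Y = []
rep (suc k) Y = Y ++ rep k Y

range1 : ℕ → List ℕ
range1 n = map suc (upTo n)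

-- curlAt U L k = k if U = X Y^k with |Y| = L (so Y is the last L letters of U
-- and X the first |U| - kL letters), with kL ≤ |U|; otherwise 0.
curlAt : List ℕ → ℕ → ℕ → ℕ
curlAt U L k =
  if does (k * L ≤? length U)
     ∧ does (≡-dec _≟ℕ_ U (take (length U ∸ k * L) U ++ rep k (drop (length U ∸ L) U)))
  then k else 0

-- Curling number C(U): the largest k ≥ 1 with U = X Y^k, Y nonempty.
-- (Since Y is nonempty, 1 ≤ |Y| ≤ |U| and 1 ≤ k ≤ |U|, so the search is exhaustive.
--  For U nonempty the value is ≥ 1; the value on [] is irrelevant.)
curl : List ℕ → ℕ
curl U = foldr _⊔_ 0 (concatMap (λ L → map (curlAt U L) (range1 (length U))) (range1 (length U)))

curlm : ℕ → List ℕ → ℕ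
curlm m U = m ⊔ curl U

-- A m i = a^{(m)}(1), ..., a^{(m)}(i)  (prefix of length i of A^{(m)})
A : ℕ → ℕ → List ℕ
A m zero = []
A m (suc zero) = m ∷ []
A m (suc (suc i)) = A m (suc i) ++ (curlm m (A m (suc i)) ∷ [])

-- For a finite block B: sList m B j = s(1), ..., s(j), where
-- s(1) = C^{(m)}(B^{m+1}), s(i+1) = C^{(m)}(B^{m+1} s(1) ... s(i)).
sList : ℕ → List ℕ → ℕ → List ℕ
sList m B zero = []
sList m B (suc j) = sList m B j ++ (curlm m (rep (suc m) B ++ sList m B j) ∷ [])

-- sNext m B j = s(j+1)
sNext : ℕ → List ℕ → ℕ → ℕ
sNext m B j = curlm m (rep (suc m) B ++ sList m B j)

-- The glue S_n for (finite) block B is finite and equal to S: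
-- S = s(1..i) with i ≥ 1 least such that s(i+1) < m+1.
FiniteGlue : ℕ → List ℕ → List ℕ → Set
FiniteGlue m B S =
  Σ ℕ λ i → (1 ≤ i) × (S ≡ sList m B i) × (sNext m B i < suc m)
          × (∀ j → 1 ≤ j → j < i → suc m ≤ sNext m B j)

-- The glue for block B is infinite: no i ≥ 1 has s(i+1) < m+1
-- (so S = s(1), s(2), ...).
InfiniteGlue : ℕ → List ℕ → Set
InfiniteGlue m B = ∀ j → 1 ≤ j → suc m ≤ sNext m B j

-- Stage m n B T : the glues S_1^{(m)}, ..., S_{n-1}^{(m)} are all finite,
-- B_n^{(m)} = B (finite) and T_n^{(m)} = S_1 ⋯ S_{n-1} = T.
data Stage (m : ℕ) : ℕ → List ℕ → List ℕ → Set where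
  stage1 : Stage m 1 (m ∷ []) []
  stageS : ∀ {n B T S} → Stage m n B T → FiniteGlue m B S →
           Stage m (suc n) (rep (suc m) B ++ S) (T ++ S)

-- Along the stages, the block B = B_n^{(m)} and T = T_n^{(m)} keep an invariant: B starts
-- with m, ends with m ∷ T, every letter of T exceeds m, and m ∷ T occurs in B only as its
-- suffix. Under it, for any word X of letters > m the curling numbers of B^{m+1} ++ X and
-- T ++ X agree once both are raised to at least m+1: a tail Y^c of B^{m+1} ++ X with
-- c ≥ m+2 cannot reach the m in front of T, for either Y lies inside T ++ X and all letters
-- of Y^c exceed m, or Y is longer and the occurrence of m ∷ T in its penultimate copy makes
-- Y a power of B, too long to fit m+2 times into B^{m+1}. Hence the glue of B (whose letters
-- exceed m) is generated from T exactly as A^{(m+1)} extends itself, so T ++ S_n is again a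
-- prefix of A^{(m+1)}, and the next block B^{m+1} ++ S_n satisfies the invariant again.

module Submission where

open import Defs
open import Data.Bool using (_∧_; if_then_else_)
open import Data.Empty using (⊥; ⊥-elim)
open import Data.List using (List; []; _∷_; [_]; _++_; length; take; drop; map; concatMap; foldr)
open import Data.List.Properties using (≡-dec; ++-assoc; ++-identityʳ; ++-cancelˡ; length-++; length-drop; length-++-≤ˡ; length-++-≤ʳ; ∷-injective; ++-monoid)
open import Data.List.Membership.Propositional using (_∈_; find; lose)
open import Data.List.Membership.Propositional.Properties using (∈-++⁺ʳ; ∈-concatMap⁺; ∈-concatMap⁻; ∈-map⁺; ∈-map⁻; ∈-upTo⁺; ∈-upTo⁻)
open import Data.List.Relation.Unary.All using (All; []; _∷_; lookup)
open import Data.List.Relation.Unary.All.Properties using (++⁺; ++⁻ʳ)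
open import Data.List.Relation.Unary.Any using (here; there)
open import Data.Nat using (ℕ; zero; suc; _+_; _*_; _∸_; _≤_; _<_; _⊔_; _≤?_; _<?_; z≤n; s≤s; >-nonZero)
open import Data.Nat.Properties
open import Algebra.Solver.Monoid (++-monoid ℕ) using (solve; _⊜_; _⊕_)
open import Data.Product using (∃; ∃₂; _×_; _,_; proj₁; proj₂)
open import Data.Sum using (_⊎_; inj₁; inj₂)
open import Relation.Nullary using (Dec; does; yes; no)
open import Relation.Nullary.Decidable using (dec-true)
open import Relation.Binary.PropositionalEquality using (_≡_; refl; sym; trans; cong; cong₂; subst; subst₂; module ≡-Reasoning)

module _ {A : Set} where

  ++-split-≤ˡ : ∀ (a b c d : List A) → a ++ b ≡ c ++ d → length a ≤ length c →
                ∃ λ e → c ≡ a ++ e × b ≡ e ++ d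
  ++-split-≤ˡ []      b c       d eq _ = c , refl , eq
  ++-split-≤ˡ (x ∷ a) b (y ∷ c) d eq (s≤s a≤c) with ∷-injective eq
  ... | refl , eq′ with ++-split-≤ˡ a b c d eq′ a≤c
  ...   | e , c≡ , b≡ = e , cong (x ∷_) c≡ , b≡

  ++-split-≤ʳ : ∀ (a b c d : List A) → a ++ b ≡ c ++ d → length b ≤ length d →
                ∃ λ e → a ≡ c ++ e × d ≡ e ++ b
  ++-split-≤ʳ a b c d eq b≤d = ++-split-≤ˡ c d a b (sym eq) c≤a
    where
    c≤a : length c ≤ length a
    c≤a = +-cancelʳ-≤ (length d) (length c) (length a) (begin
      length c + length d  ≡⟨ length-++ c ⟨
      length (c ++ d)      ≡⟨ cong length eq ⟨
      length (a ++ b)      ≡⟨ length-++ a ⟩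
      length a + length b  ≤⟨ +-monoʳ-≤ (length a) b≤d ⟩
      length a + length d  ∎)
      where open ≤-Reasoning

  split-point-∈ˡ : ∀ (S V e W : List A) {x} → S ++ V ≡ e ++ x ∷ W → length e < length S → x ∈ S
  split-point-∈ˡ (s ∷ S) V []      W eq _        = here (sym (proj₁ (∷-injective eq)))
  split-point-∈ˡ (s ∷ S) V (y ∷ e) W eq (s≤s lt) = there (split-point-∈ˡ S V e W (proj₂ (∷-injective eq)) lt)

  suffix-after : ∀ (Q W Z V : List A) {x} → Q ++ x ∷ W ≡ Z ++ V → length V ≤ length W →
                 ∃ λ e → W ≡ e ++ V
  suffix-after Q W Z V {x} eq V≤W = proj₁ split , proj₂ (proj₂ split)
    where
    split = ++-split-≤ʳ Z V (Q ++ [ x ]) W (sym (trans (++-assoc Q [ x ] W) eq)) V≤W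

  split-point-∈ʳ : ∀ (Q W Z V : List A) {x} → Q ++ x ∷ W ≡ Z ++ V → length W < length V → x ∈ V
  split-point-∈ʳ Q W Z V {x} eq W<V with ++-split-≤ʳ Q (x ∷ W) Z V eq W<V
  ... | e , _ , V≡ = subst (x ∈_) (sym V≡) (∈-++⁺ʳ e (here refl))

  take-++-length : ∀ (a b : List A) → take (length a) (a ++ b) ≡ a
  take-++-length []      b = refl
  take-++-length (x ∷ a) b = cong (x ∷_) (take-++-length a b)

  drop-++-length : ∀ (a b : List A) → drop (length a) (a ++ b) ≡ b
  drop-++-length []      b = refl
  drop-++-length (x ∷ a) b = drop-++-length a b

  prefix-length-< : ∀ (a X P c : List A) {x} → a ++ X ≡ P ++ x ∷ c → length X ≤ length c → length P < length a
  prefix-length-< a X P c {x} eq X≤c = +-cancelʳ-≤ (length X) (suc (length P)) (length a) (begin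
    suc (length P) + length X  ≤⟨ +-monoʳ-≤ (suc (length P)) X≤c ⟩
    suc (length P) + length c  ≡⟨ +-suc (length P) (length c) ⟨
    length P + length (x ∷ c)  ≡⟨ length-++ P ⟨
    length (P ++ x ∷ c)        ≡⟨ cong length eq ⟨
    length (a ++ X)            ≡⟨ length-++ a ⟩
    length a + length X        ∎)
    where open ≤-Reasoning

length-rep : ∀ k (Y : List ℕ) → length (rep k Y) ≡ k * length Y
length-rep zero    Y = refl
length-rep (suc k) Y = trans (length-++ Y) (cong (length Y +_) (length-rep k Y))

length-rep-≤ : ∀ (Z : List ℕ) k Y → k * length Y ≤ length (Z ++ rep k Y)
length-rep-≤ Z k Y = subst (k * length Y ≤_) (sym (trans (length-++ Z) (cong (length Z +_) (length-rep k Y))))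
                           (m≤n+m (k * length Y) (length Z))

length-conjugate-rep : ∀ k (B X Y : List ℕ) → rep k B ++ X ≡ X ++ Y → length Y ≡ k * length B
length-conjugate-rep k B X Y eq = +-cancelˡ-≡ (length X) (length Y) (k * length B) (begin
  length X + length Y          ≡⟨ length-++ X ⟨
  length (X ++ Y)              ≡⟨ cong length eq ⟨
  length (rep k B ++ X)        ≡⟨ length-++ (rep k B) ⟩
  length (rep k B) + length X  ≡⟨ +-comm (length (rep k B)) (length X) ⟩
  length X + length (rep k B)  ≡⟨ cong (length X +_) (length-rep k B) ⟩
  length X + k * length B      ∎)
  where open ≡-Reasoning

++-rep-sucʳ : ∀ (Z : List ℕ) k Y → Z ++ rep (suc k) Y ≡ (Z ++ rep k Y) ++ Y
++-rep-sucʳ Z k Y = trans (cong (Z ++_) (rep-sucʳ k)) (sym (++-assoc Z (rep k Y) Y))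
  where
  rep-sucʳ : ∀ k → rep (suc k) Y ≡ rep k Y ++ Y
  rep-sucʳ zero    = ++-identityʳ Y
  rep-sucʳ (suc k) = trans (cong (Y ++_) (rep-sucʳ k)) (sym (++-assoc Y (rep k Y) Y))

All-rep : ∀ {P : ℕ → Set} k {Y} → All P Y → All P (rep k Y)
All-rep zero    _  = []
All-rep (suc k) pY = ++⁺ pY (All-rep k pY)

≤-foldr-⊔ : ∀ {x xs} → x ∈ xs → x ≤ foldr _⊔_ 0 xs
≤-foldr-⊔ {xs = y ∷ ys} (here refl) = m≤m⊔n y _
≤-foldr-⊔ {xs = y ∷ ys} (there x∈) = ≤-trans (≤-foldr-⊔ x∈) (m≤n⊔m y _)

foldr-⊔-sel : ∀ xs → foldr _⊔_ 0 xs ≡ 0 ⊎ foldr _⊔_ 0 xs ∈ xs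
foldr-⊔-sel []       = inj₁ refl
foldr-⊔-sel (x ∷ xs) with ⊔-sel x (foldr _⊔_ 0 xs)
... | inj₁ ≡x = inj₂ (here ≡x)
... | inj₂ ≡max with foldr-⊔-sel xs
...   | inj₁ ≡0   = inj₁ (trans ≡max ≡0)
...   | inj₂ max∈ = inj₂ (there (subst (_∈ xs) (sym ≡max) max∈))

∈-range1⁺ : ∀ {L n} → 1 ≤ L → L ≤ n → L ∈ range1 n
∈-range1⁺ {suc L} _ L≤n = ∈-map⁺ suc (∈-upTo⁺ L≤n)

∈-range1⁻ : ∀ {L n} → L ∈ range1 n → 1 ≤ L × L ≤ n
∈-range1⁻ L∈ with ∈-map⁻ suc L∈
... | _ , L′∈ , refl = s≤s z≤n , ∈-upTo⁻ L′∈

curlCandidates : List ℕ → List ℕ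
curlCandidates U = concatMap (λ L → map (curlAt U L) (range1 (length U))) (range1 (length U))

Repetition : List ℕ → ℕ → ℕ → Set
Repetition U L k = U ≡ take (length U ∸ k * L) U ++ rep k (drop (length U ∸ L) U)

curlAt-intro : ∀ U L k → k * L ≤ length U → Repetition U L k → curlAt U L k ≡ k
curlAt-intro U L k kL≤ U≡ =
  cong₂ (λ p q → if p ∧ q then k else 0)
        (dec-true (k * L ≤? length U) kL≤) (dec-true (≡-dec _≟_ U _) U≡)

curlAt-cases : ∀ U L k → curlAt U L k ≡ 0 ⊎ (curlAt U L k ≡ k × Repetition U L k)
curlAt-cases U L k = cases (k * L ≤? length U) (≡-dec _≟_ U _)
  where
  cases : ∀ {P Q : Set} (p? : Dec P) (q? : Dec Q) →
          let v = if does p? ∧ does q? then k else 0 in v ≡ 0 ⊎ (v ≡ k × Q)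
  cases (yes _) (yes q) = inj₂ (refl , q)
  cases (yes _) (no _)  = inj₁ refl
  cases (no _)  _       = inj₁ refl

curlAt-repetition : ∀ Z Y k → curlAt (Z ++ rep (suc k) Y) (length Y) (suc k) ≡ suc k
curlAt-repetition Z Y k = curlAt-intro U L (suc k) (length-rep-≤ Z (suc k) Y) (sym (cong₂ (λ X Y′ → X ++ rep (suc k) Y′) take≡ drop≡))
  where
  U = Z ++ rep (suc k) Y
  L = length Y
  n≡ : length U ≡ length Z + suc k * L
  n≡ = trans (length-++ Z) (cong (length Z +_) (length-rep (suc k) Y))
  take≡ : take (length U ∸ suc k * L) U ≡ Z
  take≡ = trans (cong (λ i → take i U) (trans (cong (_∸ suc k * L) n≡) (m+n∸n≡m (length Z) (suc k * L))))
                (take-++-length Z (rep (suc k) Y))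
  drop≡ : drop (length U ∸ L) U ≡ Y
  drop≡ = begin
    drop (length U ∸ L) U                            ≡⟨ cong (λ W → drop (length W ∸ L) W) U≡ ⟩
    drop (length W ∸ L) W                            ≡⟨ cong (λ i → drop (i ∸ L) W) (length-++ (Z ++ rep k Y)) ⟩
    drop (length (Z ++ rep k Y) + L ∸ L) W           ≡⟨ cong (λ i → drop i W) (m+n∸n≡m _ L) ⟩
    drop (length (Z ++ rep k Y)) W                   ≡⟨ drop-++-length (Z ++ rep k Y) Y ⟩
    Y                                                ∎
    where
    open ≡-Reasoning
    W = (Z ++ rep k Y) ++ Y
    U≡ : U ≡ W
    U≡ = ++-rep-sucʳ Z k Y

≤-curl : ∀ Z Y k → 1 ≤ k → 1 ≤ length Y → k ≤ curl (Z ++ rep k Y)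
≤-curl Z Y (suc k) _ 1≤L = ≤-foldr-⊔ (∈-concatMap⁺ _ (lose L∈ k∈))
  where
  U = Z ++ rep (suc k) Y
  L = length Y
  kL≤n : suc k * L ≤ length U
  kL≤n = length-rep-≤ Z (suc k) Y
  L∈ : L ∈ range1 (length U)
  L∈ = ∈-range1⁺ 1≤L (≤-trans (m≤m+n L (k * L)) kL≤n)
  k∈ : suc k ∈ map (curlAt U L) (range1 (length U))
  k∈ = subst (_∈ map (curlAt U L) (range1 (length U))) (curlAt-repetition Z Y k)
         (∈-map⁺ (curlAt U L) (∈-range1⁺ (s≤s z≤n) (≤-trans (m≤m*n (suc k) L {{>-nonZero 1≤L}}) kL≤n)))

curl-repetition : ∀ U → curl U ≡ 0 ⊎ ∃₂ λ Z Y → 1 ≤ length Y × U ≡ Z ++ rep (curl U) Y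
curl-repetition U with foldr-⊔-sel (curlCandidates U)
... | inj₁ ≡0 = inj₁ ≡0
... | inj₂ max∈ with find (∈-concatMap⁻ (λ L → map (curlAt U L) (range1 (length U))) {xs = range1 (length U)} max∈)
... | L , L∈ , max∈L with ∈-map⁻ (curlAt U L) max∈L
... | k , _ , max≡ with curlAt-cases U L k
... | inj₁ ≡0 = inj₁ (trans max≡ ≡0)
... | inj₂ (≡k , U≡) =
  inj₂ (take (length U ∸ k * L) U , drop (length U ∸ L) U , 1≤|Y| ,
        subst (λ c → U ≡ take (length U ∸ k * L) U ++ rep c (drop (length U ∸ L) U)) (sym (trans max≡ ≡k)) U≡)
  where
  1≤|Y| : 1 ≤ length (drop (length U ∸ L) U)
  1≤|Y| = subst (1 ≤_) (sym (trans (length-drop (length U ∸ L) U) (m∸[m∸n]≡n (proj₂ (∈-range1⁻ L∈)))))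
                (proj₁ (∈-range1⁻ L∈))

curl-++-≥ : ∀ U V → curl V ≤ curl (U ++ V)
curl-++-≥ U V with curl-repetition V
... | inj₁ ≡0 = subst (_≤ curl (U ++ V)) (sym ≡0) z≤n
... | inj₂ (Z , Y , 1≤|Y| , V≡) with curl V
...   | zero  = z≤n
...   | suc c = subst (λ W → suc c ≤ curl W) (sym (trans (cong (U ++_) V≡) (sym (++-assoc U Z _))))
                      (≤-curl (U ++ Z) Y (suc c) (s≤s z≤n) 1≤|Y|)

-- This also rules out occurrences of p that start inside B and run past its end.
OccursOnlyAsSuffix : List ℕ → List ℕ → Set
OccursOnlyAsSuffix p B = ∀ V P R → B ++ V ≡ P ++ p ++ R → length P < length B → P ++ p ≡ B

occurrence-in-rep : ∀ {p B} → OccursOnlyAsSuffix p B → ∀ j V P R →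
                    rep j B ++ V ≡ P ++ p ++ R → length P < length (rep j B) →
                    ∃₂ λ i k → suc i + k ≡ j × P ++ p ≡ rep (suc i) B × rep k B ++ V ≡ R
occurrence-in-rep {p} {B} only (suc j) V P R eq P< with length P <? length B
... | yes P<B = 0 , j , refl , trans Pp≡B (sym (++-identityʳ B)) , ++-cancelˡ B _ R Bj≡BR
  where
  eq′ : B ++ (rep j B ++ V) ≡ P ++ p ++ R
  eq′ = trans (sym (++-assoc B (rep j B) V)) eq
  Pp≡B : P ++ p ≡ B
  Pp≡B = only (rep j B ++ V) P R eq′ P<B
  Bj≡BR : B ++ (rep j B ++ V) ≡ B ++ R
  Bj≡BR = trans eq′ (trans (sym (++-assoc P p R)) (cong (_++ R) Pp≡B))
... | no P≮B with ++-split-≤ˡ B (rep j B ++ V) P (p ++ R) (trans (sym (++-assoc B (rep j B) V)) eq) (≮⇒≥ P≮B)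
... | e , P≡ , eq′ with occurrence-in-rep only j V e R eq′ e<
  where
  e< : length e < length (rep j B)
  e< = +-cancelˡ-< (length B) (length e) (length (rep j B))
         (subst₂ _<_ (trans (cong length P≡) (length-++ B)) (length-++ B) P<)
... | i , k , i+k≡j , ep≡ , R≡ = suc i , k , cong suc i+k≡j , Pp≡ , R≡
  where
  Pp≡ : P ++ p ≡ rep (suc (suc i)) B
  Pp≡ = trans (cong (_++ p) P≡) (trans (++-assoc B e p) (cong (B ++_) ep≡))

rep-++-≡-∷ : ∀ {m x B B′ U} k V → B ≡ m ∷ B′ → rep k B ++ V ≡ x ∷ U → m < x → k ≡ 0
rep-++-≡-∷ zero    V _    _  _   = refl
rep-++-≡-∷ (suc k) V refl eq m<x = ⊥-elim (<-irrefl (proj₁ (∷-injective eq)) m<x)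

above-suffix-length : ∀ {m} Q W Z V → Q ++ m ∷ W ≡ Z ++ V → All (m <_) V → length V ≤ length W
above-suffix-length Q W Z V eq aV = ≮⇒≥ λ W<V → <-irrefl refl (lookup aV (split-point-∈ʳ Q W Z V eq W<V))

too-many-copies : ∀ {m c b y} → suc (suc m) ≤ c → 1 ≤ b → b ≤ y → c * y ≤ suc m * b → ⊥
too-many-copies {m} {c} {b} {y} c≥ 1≤b b≤y cy≤ = <-irrefl refl (begin-strict
  suc m * b        <⟨ m<n+m (suc m * b) 1≤b ⟩
  suc (suc m) * b  ≤⟨ *-mono-≤ c≥ b≤y ⟩
  c * y            ≤⟨ cy≤ ⟩
  suc m * b        ∎)
  where open ≤-Reasoning

length-sList : ∀ m B i → length (sList m B i) ≡ i
length-sList m B zero    = refl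
length-sList m B (suc i) = trans (length-++ (sList m B i)) (trans (cong (_+ 1) (length-sList m B i)) (+-comm i 1))

All-sList : ∀ {m B} i → (∀ j → j < i → suc m ≤ sNext m B j) → All (m <_) (sList m B i)
All-sList zero    _     = []
All-sList (suc i) large = ++⁺ (All-sList i (λ j j<i → large j (m<n⇒m<1+n j<i))) (large i (n<1+n i) ∷ [])

⊔-≡-suc-⊔ : ∀ {m n} → suc m ≤ m ⊔ n → m ⊔ n ≡ suc m ⊔ n
⊔-≡-suc-⊔ {m} {n} m<m⊔n with n ≤? m
... | yes n≤m = ⊥-elim (<-irrefl (sym (m≥n⇒m⊔n≡m n≤m)) m<m⊔n)
... | no n≰m  = trans (m≤n⇒m⊔n≡n (<⇒≤ (≰⇒> n≰m))) (sym (m≤n⇒m⊔n≡n (≰⇒> n≰m)))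

A-suc : ∀ m i → A m (suc i) ≡ A m i ++ [ curlm m (A m i) ]
A-suc m zero    = cong [_] (sym (⊔-identityʳ m))
A-suc m (suc i) = refl

record Block (m : ℕ) (B T : List ℕ) : Set where
  field
    B′              : List ℕ
    B≡m∷B′          : B ≡ m ∷ B′
    R               : List ℕ
    B≡R++m∷T        : B ≡ R ++ m ∷ T
    T-above         : All (m <_) T
    m∷T-only-suffix : OccursOnlyAsSuffix (m ∷ T) B

block-initial : ∀ m → Block m [ m ] []
block-initial m = record
  { B′ = [] ; B≡m∷B′ = refl ; R = [] ; B≡R++m∷T = refl ; T-above = []
  ; m∷T-only-suffix = λ { V [] R eq _ → refl ; V (_ ∷ P) R eq (s≤s ()) } }

module BlockProperties {m B T} (blk : Block m B T) where
  open Block blk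

  1≤|B| : 1 ≤ length B
  1≤|B| = subst (λ b → 1 ≤ length b) (sym B≡m∷B′) (s≤s z≤n)

  rep-B-++ : ∀ X → rep (suc m) B ++ X ≡ (rep m B ++ R) ++ m ∷ (T ++ X)
  rep-B-++ X = begin
    (B ++ rep m B) ++ X              ≡⟨ cong (_++ X) (++-rep-sucʳ [] m B) ⟩
    (rep m B ++ B) ++ X              ≡⟨ cong (λ b → (rep m B ++ b) ++ X) B≡R++m∷T ⟩
    (rep m B ++ (R ++ m ∷ T)) ++ X   ≡⟨ solve 5 (λ b r x t y → (b ⊕ (r ⊕ (x ⊕ t))) ⊕ y ⊜ (b ⊕ r) ⊕ (x ⊕ (t ⊕ y)))
                                               refl (rep m B) R [ m ] T X ⟩
    (rep m B ++ R) ++ m ∷ (T ++ X)   ∎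
    where open ≡-Reasoning

  -- The penultimate copy of Y contains an occurrence of m ∷ T starting inside B^{m+1}; it ends
  -- at a copy of B, and comparing what follows it on both sides gives B^k ++ X ≡ X ++ Y.
  long-period-conjugate : ∀ {X Z Y c} → rep (suc m) B ++ X ≡ Z ++ rep (suc (suc c)) Y →
                          length (T ++ X) < length Y → ∃ λ k → rep k B ++ X ≡ X ++ Y
  long-period-conjugate {X} {Z} {Y} {c} eq W<Y
    with ++-split-≤ʳ (rep m B ++ R) (m ∷ (T ++ X)) (Z ++ rep (suc c) Y) Y
                     (trans (sym (rep-B-++ X)) (trans eq (++-rep-sucʳ Z (suc c) Y))) W<Y
  ... | e , _ , Y≡ with occurrence-in-rep m∷T-only-suffix (suc m) X P (X ++ Y) eq′ P<
    where
    P = (Z ++ rep c Y) ++ e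
    eq′ : rep (suc m) B ++ X ≡ P ++ m ∷ (T ++ (X ++ Y))
    eq′ = begin
      rep (suc m) B ++ X                          ≡⟨ eq ⟩
      Z ++ rep (suc (suc c)) Y                    ≡⟨ ++-rep-sucʳ Z (suc c) Y ⟩
      (Z ++ rep (suc c) Y) ++ Y                   ≡⟨ cong (_++ Y) (++-rep-sucʳ Z c Y) ⟩
      ((Z ++ rep c Y) ++ Y) ++ Y                  ≡⟨ cong (λ y → ((Z ++ rep c Y) ++ y) ++ Y) Y≡ ⟩
      ((Z ++ rep c Y) ++ (e ++ m ∷ (T ++ X))) ++ Y
        ≡⟨ solve 6 (λ z e x t u y → (z ⊕ (e ⊕ (x ⊕ (t ⊕ u)))) ⊕ y ⊜ (z ⊕ e) ⊕ (x ⊕ (t ⊕ (u ⊕ y))))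
                   refl (Z ++ rep c Y) e [ m ] T X Y ⟩
      P ++ m ∷ (T ++ (X ++ Y))                    ∎
      where open ≡-Reasoning
    P< : length P < length (rep (suc m) B)
    P< = prefix-length-< (rep (suc m) B) X P (T ++ (X ++ Y)) eq′
           (≤-trans (length-++-≤ˡ X) (length-++-≤ʳ (X ++ Y) {T}))
  ... | _ , k , _ , _ , R≡ = k , R≡

  -- X = [] since B starts with m, so Y = B^k is too long to fit c ≥ m+2 times into B^{m+1}.
  no-conjugate-period : ∀ {X Z Y c} k → All (m <_) X → rep (suc m) B ++ X ≡ Z ++ rep c Y →
                        suc (suc m) ≤ c → 1 ≤ length Y → rep k B ++ X ≡ X ++ Y → ⊥
  no-conjugate-period {X} {Y = Y} zero _ _ _ 1≤|Y| eqk = <-irrefl (sym (length-conjugate-rep 0 B X Y eqk)) 1≤|Y|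
  no-conjugate-period {X} (suc k) (px ∷ _) _ _ _ eqk = 0≢1+n (sym (rep-++-≡-∷ (suc k) X B≡m∷B′ eqk px))
  no-conjugate-period {Z = Z} {Y} {c} (suc k) [] eq c≥ _ eqk =
    too-many-copies c≥ 1≤|B| |B|≤|Y| (≤-trans (length-rep-≤ Z c Y) (≤-reflexive |eq|))
    where
    |B|≤|Y| : length B ≤ length Y
    |B|≤|Y| = subst (length B ≤_) (sym (length-conjugate-rep (suc k) B [] Y eqk)) (m≤m+n (length B) (k * length B))
    |eq| : length (Z ++ rep c Y) ≡ suc m * length B
    |eq| = trans (cong length (sym eq)) (trans (cong length (++-identityʳ (rep (suc m) B))) (length-rep (suc m) B))

  repetition-in-tail : ∀ {X Z Y c} → All (m <_) X → rep (suc m) B ++ X ≡ Z ++ rep c Y →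
                       suc (suc m) ≤ c → 1 ≤ length Y → length (rep c Y) ≤ length (T ++ X)
  repetition-in-tail {c = suc zero} _ _ (s≤s ()) _
  repetition-in-tail {X} {Z} {Y} {suc (suc c)} aX eq c≥ 1≤|Y| with length Y ≤? length (T ++ X)
  ... | yes short = above-suffix-length (rep m B ++ R) (T ++ X) Z (rep (suc (suc c)) Y) eq₁ (All-rep (suc (suc c)) aY)
    where
    eq₁ : (rep m B ++ R) ++ m ∷ (T ++ X) ≡ Z ++ rep (suc (suc c)) Y
    eq₁ = trans (sym (rep-B-++ X)) eq
    aY : All (m <_) Y
    aY with suffix-after (rep m B ++ R) (T ++ X) (Z ++ rep (suc c) Y) Y (trans eq₁ (++-rep-sucʳ Z (suc c) Y)) short
    ... | e , W≡ = ++⁻ʳ e (subst (All (m <_)) W≡ (++⁺ T-above aX))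
  ... | no long = ⊥-elim (no-conjugate-period {X} {Z} {Y} (proj₁ conj) aX eq c≥ 1≤|Y| (proj₂ conj))
    where
    conj = long-period-conjugate {X} {Z} {Y} {c} eq (≰⇒> long)

  curlm-block-tail : ∀ X → All (m <_) X → curlm (suc m) (rep (suc m) B ++ X) ≡ curlm (suc m) (T ++ X)
  curlm-block-tail X aX = ≤-antisym (⊔-lub (m≤m⊔n (suc m) (curl W)) curl-U≤) (⊔-monoʳ-≤ (suc m) curl-W≤)
    where
    U = rep (suc m) B ++ X
    W = T ++ X
    Q = rep m B ++ R
    U≡ : U ≡ Q ++ m ∷ W
    U≡ = rep-B-++ X
    curl-W≤ : curl W ≤ curl U
    curl-W≤ = subst (λ V → curl W ≤ curl V) (sym (trans U≡ (sym (++-assoc Q [ m ] W)))) (curl-++-≥ (Q ++ [ m ]) W)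
    curl-U≤ : curl U ≤ suc m ⊔ curl W
    curl-U≤ with curl-repetition U
    ... | inj₁ ≡0 = subst (_≤ suc m ⊔ curl W) (sym ≡0) z≤n
    ... | inj₂ (Z , Y , 1≤|Y| , U≡Z++Yᶜ) with curl U ≤? suc m
    ...   | yes c≤ = ≤-trans c≤ (m≤m⊔n (suc m) (curl W))
    ...   | no c≰ = ≤-trans (subst (λ V → curl U ≤ curl V) (sym W≡) (≤-curl e Y (curl U) 1≤c 1≤|Y|)) (m≤n⊔m (suc m) (curl W))
      where
      1≤c : 1 ≤ curl U
      1≤c = ≤-trans (s≤s z≤n) (≰⇒> c≰)
      split = suffix-after Q W Z (rep (curl U) Y) (trans (sym U≡) U≡Z++Yᶜ)
                (repetition-in-tail aX U≡Z++Yᶜ (≰⇒> c≰) 1≤|Y|)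
      e = proj₁ split
      W≡ : W ≡ e ++ rep (curl U) Y
      W≡ = proj₂ split

  suc-m≤sNext₀ : suc m ≤ sNext m B 0
  suc-m≤sNext₀ = ≤-trans (subst (λ V → suc m ≤ curl V) (sym (++-identityʳ (rep (suc m) B)))
                                (≤-curl [] B (suc m) (s≤s z≤n) 1≤|B|))
                         (m≤n⊔m m _)

  block-step : ∀ {S} → All (m <_) S → 0 < length S → Block m (rep (suc m) B ++ S) (T ++ S)
  block-step {s ∷ S′} aS@(m<s ∷ _) _ = record
    { B′              = (B′ ++ rep m B) ++ S
    ; B≡m∷B′          = cong (λ b → (b ++ rep m B) ++ S) B≡m∷B′
    ; R               = rep m B ++ R
    ; B≡R++m∷T        = rep-B-++ S
    ; T-above         = ++⁺ T-above aS
    ; m∷T-only-suffix = only-suffix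
    }
    where
    S = s ∷ S′
    only-suffix : OccursOnlyAsSuffix (m ∷ T ++ S) (rep (suc m) B ++ S)
    only-suffix V P R′ eq P< with occurrence-in-rep m∷T-only-suffix (suc m) (S ++ V) P (S ++ R′) eq′ P<Bᵐ⁺¹
      where
      eq″ : rep (suc m) B ++ (S ++ V) ≡ P ++ m ∷ ((T ++ S) ++ R′)
      eq″ = trans (sym (++-assoc (rep (suc m) B) S V)) eq
      eq′ : rep (suc m) B ++ (S ++ V) ≡ P ++ m ∷ (T ++ (S ++ R′))
      eq′ = trans eq″ (cong (λ u → P ++ m ∷ u) (++-assoc T S R′))
      -- An occurrence starting inside S would put an m inside S.
      P<Bᵐ⁺¹ : length P < length (rep (suc m) B)
      P<Bᵐ⁺¹ with length P <? length (rep (suc m) B)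
      ... | yes P< = P<
      ... | no P≮ with ++-split-≤ˡ (rep (suc m) B) (S ++ V) P (m ∷ ((T ++ S) ++ R′)) eq″ (≮⇒≥ P≮)
      ...   | e , P≡ , eqS = ⊥-elim (<-irrefl refl (lookup aS (split-point-∈ˡ S V e _ eqS e<S)))
        where
        e<S : length e < length S
        e<S = +-cancelˡ-< (length (rep (suc m) B)) (length e) (length S)
                (subst₂ _<_ (trans (cong length P≡) (length-++ (rep (suc m) B))) (length-++ (rep (suc m) B)) P<)
    ... | i , k , i+k≡ , Pp≡ , R≡ = begin
      P ++ m ∷ (T ++ S)      ≡⟨ ++-assoc P (m ∷ T) S ⟨
      (P ++ m ∷ T) ++ S      ≡⟨ cong (_++ S) Pp≡ ⟩
      rep (suc i) B ++ S     ≡⟨ cong (λ j → rep j B ++ S) i≡m ⟩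
      rep (suc m) B ++ S     ∎
      where
      open ≡-Reasoning
      k≡0 : k ≡ 0
      k≡0 = rep-++-≡-∷ k (S ++ V) B≡m∷B′ R≡ m<s
      i≡m : suc i ≡ suc m
      i≡m = trans (sym (+-identityʳ (suc i))) (subst (λ k → suc i + k ≡ suc m) k≡0 i+k≡)

  sNext-large : ∀ {i} → (∀ j → 1 ≤ j → j < i → suc m ≤ sNext m B j) → ∀ j → j < i → suc m ≤ sNext m B j
  sNext-large _     zero    _   = suc-m≤sNext₀
  sNext-large large (suc j) j<i = large (suc j) (s≤s z≤n) j<i

  glue-follows-A : T ≡ A (suc m) (length T) → ∀ i → (∀ j → j < i → suc m ≤ sNext m B j) →
                   T ++ sList m B i ≡ A (suc m) (length T + i)
  glue-follows-A T≡ zero _ = trans (++-identityʳ T) (trans T≡ (cong (A (suc m)) (sym (+-identityʳ (length T)))))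
  glue-follows-A T≡ (suc i) large = begin
    T ++ (sList m B i ++ [ sNext m B i ])   ≡⟨ ++-assoc T (sList m B i) _ ⟨
    (T ++ sList m B i) ++ [ sNext m B i ]   ≡⟨ cong₂ (λ u v → u ++ [ v ]) IH sNext≡ ⟩
    A′ (length T + i) ++ [ curlm (suc m) (A′ (length T + i)) ]  ≡⟨ A-suc (suc m) (length T + i) ⟨
    A′ (suc (length T + i))                 ≡⟨ cong A′ (+-suc (length T) i) ⟨
    A′ (length T + suc i)                   ∎
    where
    open ≡-Reasoning
    A′ = A (suc m)
    large′ : ∀ j → j < i → suc m ≤ sNext m B j
    large′ j j<i = large j (m<n⇒m<1+n j<i)
    IH : T ++ sList m B i ≡ A′ (length T + i)
    IH = glue-follows-A T≡ i large′
    sNext≡ : sNext m B i ≡ curlm (suc m) (A′ (length T + i))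
    sNext≡ = begin
      m ⊔ curl (rep (suc m) B ++ sList m B i)      ≡⟨ ⊔-≡-suc-⊔ (large i (n<1+n i)) ⟩
      curlm (suc m) (rep (suc m) B ++ sList m B i) ≡⟨ curlm-block-tail (sList m B i) (All-sList i large′) ⟩
      curlm (suc m) (T ++ sList m B i)             ≡⟨ cong (curlm (suc m)) IH ⟩
      curlm (suc m) (A′ (length T + i))            ∎

open BlockProperties

stage-block : ∀ {m n B T} → Stage m n B T → Block m B T × T ≡ A (suc m) (length T)
stage-block {m} stage1 = block-initial m , refl
stage-block {m} (stageS {B = B} {T} st (i , 1≤i , refl , _ , large)) = block-step blk (All-sList i large′) 0<|S| , T++S≡
  where
  blk = proj₁ (stage-block st)
  large′ = sNext-large blk large
  0<|S| : 0 < length (sList m B i)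
  0<|S| = subst (0 <_) (sym (length-sList m B i)) 1≤i
  T++S≡ : T ++ sList m B i ≡ A (suc m) (length (T ++ sList m B i))
  T++S≡ = trans (glue-follows-A blk (proj₂ (stage-block st)) i large′)
                (cong (A (suc m)) (sym (trans (length-++ T) (cong (length T +_) (length-sList m B i)))))

theorem1 : (m : ℕ) → 1 ≤ m →
    -- T_n^{(m)} finite (S_1,...,S_{n-1} finite): it is a prefix of A^{(m+1)}
    ((n : ℕ) (B T : List ℕ) → 2 ≤ n → Stage m n B T →
       T ≡ A (suc m) (length T))
    ×
    -- S_1,...,S_{k-1} finite and S_k infinite: T_n^{(m)} = S_1 ⋯ S_k (for all n ≥ k+1)
    -- is infinite and equals A^{(m+1)} (every finite prefix agrees)
    ((k : ℕ) (B T : List ℕ) → Stage m k B T → InfiniteGlue m B →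
       (j : ℕ) → T ++ sList m B j ≡ A (suc m) (length T + j))
theorem1 m _ = (λ n B T _ st → proj₂ (stage-block st)) , prefix-of-A
  where
  prefix-of-A : ∀ k B T → Stage m k B T → InfiniteGlue m B → ∀ j → T ++ sList m B j ≡ A (suc m) (length T + j)
  prefix-of-A k B T st infinite j =
    glue-follows-A blk (proj₂ (stage-block st)) j (sNext-large blk (λ j′ 1≤j′ _ → infinite j′ 1≤j′))
    where blk = proj₁ (stage-block st)
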